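{- If $T$ is a tree with radius $2$ and diameter $4$, then $\pi^{c}(T)=4$.
   Context: A configuration of cops on $T$ is a function $C:V(T)\to\mathbb{Z}_{\ge 0}$ of size $\sum_v C(v)$. A pebbling step from a vertex $u$ with at least two cops to an adjacent vertex $v$ removes two cops from $u$ and adds one cop to $v$. In the cops and robbers pebbling game, cops are placed according to $C$, then a robber chooses a starting vertex; thereafter, in each turn the cops make pebbling steps, after which the robber either moves to an adjacent vertex or stays put. The robber is captured when he occupies a vertex holding at least one cop. The cop pebbling number $\pi^{c}(T)$ is the minimum $m$ such that some configuration of size $m$ allows the cops to capture the robber regardless of how he starts and moves. -}

module Defs where

open import Level using (0ℓ)
open import Data.Nat using (ℕ; zero; suc; _+_; _∸_; _≤_; _<_)
open import Data.Fin using (Fin)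
open import Data.List using (List; []; _∷_; _++_; [_]; length; map; allFin)
open import Data.Nat.ListAction using (sum)
open import Data.List.Relation.Unary.Linked using (Linked)
open import Data.List.Relation.Unary.Unique.Propositional using (Unique)
open import Data.Product using (Σ; ∃; ∃-syntax; _×_; _,_)
open import Data.Sum using (_⊎_)
open import Relation.Nullary using (¬_)
open import Relation.Binary.PropositionalEquality using (_≡_; _≢_)
open import Relation.Binary.Construct.Closure.ReflexiveTransitive using (Star)

record Graph (n : ℕ) : Set₁ where
  field
    Adj    : Fin n → Fin n → Set
    sym    : ∀ {u v} → Adj u v → Adj v u
    irrefl : ∀ {u} → ¬ Adj u u
open Graph public

module _ {n : ℕ} (G : Graph n) where

  data Walk : Fin n → Fin n → ℕ → Set where
    here : ∀ {u} → Walk u u zero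
    step : ∀ {u v w k} → Adj G u v → Walk v w k → Walk u w (suc k)

  Connected : Set
  Connected = ∀ u v → ∃[ k ] Walk u v k

  -- a cycle: distinct vertices x, v₁, …, vₘ, w (m ≥ 1, so at least 3 vertices),
  -- consecutive ones adjacent, and w adjacent to x
  HasCycle : Set
  HasCycle = ∃[ x ] ∃[ vs ] ∃[ w ]
    (Linked (Adj G) (x ∷ (vs ++ [ w ])) × Unique (x ∷ (vs ++ [ w ]))
      × Adj G w x × 1 ≤ length vs)

  IsTree : Set
  IsTree = Connected × ¬ HasCycle

  DistLe : Fin n → Fin n → ℕ → Set
  DistLe u v d = ∃[ k ] (k ≤ d × Walk u v k)

  EccLe : Fin n → ℕ → Set
  EccLe v e = ∀ u → DistLe v u e

  Radius : ℕ → Set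
  Radius r = (∃[ v ] EccLe v r) × (∀ v e → EccLe v e → r ≤ e)

  Diameter : ℕ → Set
  Diameter d = (∀ v → EccLe v d) × (∀ e → (∀ v → EccLe v e) → d ≤ e)

  Config : Set
  Config = Fin n → ℕ

  size : Config → ℕ
  size C = sum (map C (allFin n))

  PebStep : Config → Config → Set
  PebStep C C' = ∃[ u ] ∃[ v ] (Adj G u v × 2 ≤ C u
    × C' u ≡ C u ∸ 2 × C' v ≡ suc (C v)
    × (∀ w → w ≢ u → w ≢ v → C' w ≡ C w))

  PebSteps : Config → Config → Set
  PebSteps = Star PebStep

  RobMove : Fin n → Fin n → Set
  RobMove r r' = r ≡ r' ⊎ Adj G r r'

  -- CopsWin C r : it is the cops' turn, cops are at C, robber at r
  -- (not yet captured); the cops can force a capture in finitely many turns.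
  -- Inductive (least fixed point) = capture in finite time.
  data CopsWin : Config → Fin n → Set where
    win : ∀ {C r} (C' : Config) → PebSteps C C' →
          (1 ≤ C' r ⊎ (∀ r' → RobMove r r' → 1 ≤ C' r' ⊎ CopsWin C' r')) →
          CopsWin C r

  Winning : Config → Set
  Winning C = ∀ r → 1 ≤ C r ⊎ CopsWin C r

  CopPebblingNumber : ℕ → Set
  CopPebblingNumber m =
    (∃[ C ] (size C ≡ m × Winning C)) × (∀ C → Winning C → m ≤ size C)

module Submission where

-- Four cops on a centre c win at once: 2^k cops on a vertex can push one cop along any walk
-- of length k during a single turn, and every vertex is within distance 2 of c.
-- Against at most three cops the robber stands still on a vertex r that is empty, whose
-- neighbours hold at most one cop each, and whose occupied neighbours have only neighbours
-- holding at most one cop. No pebbling step can then reach r or overfill a neighbour of r,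
-- and after a step at most two cops remain, so these conditions persist. Such an r exists
-- when the diameter is 4: if no vertex holds two cops, one of four distinct vertices on a
-- diametral path is empty; otherwise all cops sit on a heavy vertex h and at most one other
-- vertex, and an end of a diametral path away from h, or its neighbour on the path, will do.

open import Defs renaming (sym to adj-sym)
open import Data.Nat using (ℕ; zero; suc; _+_; _*_; _∸_; _^_; _≤_; _<_; z≤n; s≤s; _≤?_)
open import Data.Nat.Properties hiding (_≟_)
open import Algebra.Properties.CommutativeMonoid.Sum +-0-commutativeMonoid
  using (sum-cong-≗; sum-replicate-zero) renaming (sum to ∑)
open import Data.Nat.ListAction using (sum)
open import Data.Fin using (Fin; zero; suc; _≟_)
open import Data.Fin.Properties using (any?)
open import Data.List using ([]; _∷_; map; tabulate; length)
open import Data.List.Properties using (map-tabulate; map-cong-local)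
open import Data.List.Relation.Unary.All as All using (All; []; _∷_)
open import Data.List.Relation.Unary.All.Properties using (¬Any⇒All¬)
open import Data.List.Relation.Unary.Any as Any using (Any; satisfied)
open import Data.List.Relation.Unary.AllPairs using ([]; _∷_)
open import Data.List.Relation.Unary.Unique.Propositional using (Unique)
open import Data.Vec.Functional using (updateAt; replicate)
open import Data.Vec.Functional.Properties using (updateAt-updates; updateAt-minimal)
open import Data.Product using (∃; ∃-syntax; _×_; _,_)
open import Data.Sum using (inj₁; inj₂; [_,_])
open import Function using (id; const; _∘_)
open import Relation.Nullary using (¬_; yes; no; contradiction)
open import Relation.Nullary.Decidable using (decidable-stable; ¬¬-excluded-middle; ¬?; _×-dec_)
open import Relation.Binary.PropositionalEquality hiding ([_])
open import Relation.Binary.Construct.Closure.ReflexiveTransitive using (ε; _◅_; _◅◅_)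

¬¬-∀-Fin : ∀ {n} {P : Fin n → Set} → (∀ i → ¬ ¬ P i) → ¬ ¬ (∀ i → P i)
¬¬-∀-Fin {zero}  _   k = k (λ ())
¬¬-∀-Fin {suc n} ¬¬P k =
  ¬¬P zero λ P₀ → ¬¬-∀-Fin (¬¬P ∘ suc) λ Pₛ → k λ { zero → P₀ ; (suc i) → Pₛ i }

sum-tabulate : ∀ {n} (f : Fin n → ℕ) → sum (tabulate f) ≡ ∑ f
sum-tabulate {zero}  f = refl
sum-tabulate {suc n} f = cong (f zero +_) (sum-tabulate (f ∘ suc))

∑-updateAt : ∀ {n} (f : Fin n → ℕ) i g → ∑ (updateAt f i g) + f i ≡ ∑ f + g (f i)
∑-updateAt {suc n} f zero g = begin
  g a + s + a   ≡⟨ +-comm (g a + s) a ⟩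
  a + (g a + s) ≡⟨ cong (a +_) (+-comm (g a) s) ⟩
  a + (s + g a) ≡⟨ +-assoc a s (g a) ⟨
  a + s + g a   ∎
  where open ≡-Reasoning; a = f zero; s = ∑ (f ∘ suc)
∑-updateAt {suc n} f (suc i) g = begin
  f zero + ∑ (updateAt (f ∘ suc) i g) + f (suc i)   ≡⟨ +-assoc (f zero) _ _ ⟩
  f zero + (∑ (updateAt (f ∘ suc) i g) + f (suc i)) ≡⟨ cong (f zero +_) (∑-updateAt (f ∘ suc) i g) ⟩
  f zero + (∑ (f ∘ suc) + g (f (suc i)))            ≡⟨ +-assoc (f zero) _ _ ⟨
  f zero + ∑ (f ∘ suc) + g (f (suc i))              ∎
  where open ≡-Reasoning

sum-map-≤-∑ : ∀ {n} (f : Fin n → ℕ) {xs} → Unique xs → sum (map f xs) ≤ ∑ f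
sum-map-≤-∑ f {[]}     _                  = z≤n
sum-map-≤-∑ f {x ∷ xs} (x∉xs ∷ unique) = begin
  f x + sum (map f xs)  ≡⟨ cong (λ ys → f x + sum ys) (map-cong-local f≗f₀) ⟩
  f x + sum (map f₀ xs) ≤⟨ +-monoʳ-≤ (f x) (sum-map-≤-∑ f₀ unique) ⟩
  f x + ∑ f₀            ≡⟨ +-comm (f x) (∑ f₀) ⟩
  ∑ f₀ + f x            ≡⟨ ∑-updateAt f x (const 0) ⟩
  ∑ f + 0               ≡⟨ +-identityʳ (∑ f) ⟩
  ∑ f                   ∎
  where
  open ≤-Reasoning
  f₀ = updateAt f x (const 0)
  f≗f₀ : All (λ y → f y ≡ f₀ y) xs
  f≗f₀ = All.map (λ x≢y → sym (updateAt-minimal _ x f (x≢y ∘ sym))) x∉xs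

vacant-among : ∀ {n} (f : Fin n → ℕ) {xs} → Unique xs → ∑ f < length xs →
               Any (λ v → f v ≡ 0) xs
vacant-among f {xs} unique ∑f<len with Any.any? (λ v → f v Data.Nat.≟ 0) xs
... | yes vacant = vacant
... | no  none   = contradiction
  (≤-trans (length≤sum (All.map n≢0⇒n>0 (¬Any⇒All¬ xs none))) (sum-map-≤-∑ f unique))
  (<⇒≱ ∑f<len)
  where
  length≤sum : ∀ {ys} → All (λ v → 1 ≤ f v) ys → length ys ≤ sum (map f ys)
  length≤sum []         = z≤n
  length≤sum (p ∷ ps) = +-mono-≤ p (length≤sum ps)

module _ {n : ℕ} {f : Fin n → ℕ} (few : ∑ f ≤ 3) {h : Fin n} (heavy : 2 ≤ f h) where

  light-beside-heavy : ∀ {u} → u ≢ h → f u ≤ 1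
  light-beside-heavy {u} u≢h = +-cancelˡ-≤ 2 _ _ (begin
    2 + f u          ≤⟨ +-monoˡ-≤ (f u) heavy ⟩
    f h + f u        ≡⟨ cong (f h +_) (+-identityʳ (f u)) ⟨
    f h + (f u + 0)  ≤⟨ sum-map-≤-∑ f ((h≢u ∷ []) ∷ [] ∷ []) ⟩
    ∑ f              ≤⟨ few ⟩
    3                ∎)
    where open ≤-Reasoning; h≢u = u≢h ∘ sym

  vanishes-off-pair : ∃[ p ] (∀ w → w ≢ h → w ≢ p → f w ≡ 0)
  vanishes-off-pair with any? (λ p → ¬? (p ≟ h) ×-dec (1 ≤? f p))
  ... | yes (p , p≢h , occupied) = p , λ w w≢h w≢p → n≤0⇒n≡0 (+-cancelˡ-≤ 3 _ _ (begin
    3 + f w                  ≤⟨ +-mono-≤ heavy (+-monoˡ-≤ (f w) occupied) ⟩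
    f h + (f p + f w)        ≡⟨ cong (λ m → f h + (f p + m)) (+-identityʳ (f w)) ⟨
    f h + (f p + (f w + 0))  ≤⟨ sum-map-≤-∑ f (distinct p≢h w≢h w≢p) ⟩
    ∑ f                      ≤⟨ few ⟩
    3 + 0                    ∎))
    where
    open ≤-Reasoning
    distinct : ∀ {p w} → p ≢ h → w ≢ h → w ≢ p → Unique (h ∷ p ∷ w ∷ [])
    distinct p≢h w≢h w≢p =
      ((p≢h ∘ sym) ∷ (w≢h ∘ sym) ∷ []) ∷ ((w≢p ∘ sym) ∷ []) ∷ [] ∷ []
  ... | no none = h , λ w w≢h _ → n≤0⇒n≡0 (≤-pred (≰⇒> λ occupied → none (w , w≢h , occupied)))

module _ {n : ℕ} (G : Graph n) where

  size≡∑ : (C : Config G) → size G C ≡ ∑ C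
  size≡∑ C = trans (cong sum (map-tabulate id C)) (sum-tabulate C)

  adj⇒≢ : ∀ {u v} → Adj G u v → u ≢ v
  adj⇒≢ u~v refl = irrefl G u~v

  walk-snoc : ∀ {u v w k} → Walk G u v k → Adj G v w → Walk G u w (suc k)
  walk-snoc here       v~w = step v~w here
  walk-snoc (step e p) v~w = step e (walk-snoc p v~w)

  walk-reverse : ∀ {u v k} → Walk G u v k → Walk G v u k
  walk-reverse here       = here
  walk-reverse (step e p) = walk-snoc (walk-reverse p) (adj-sym G e)

  walk-++ : ∀ {u v w k l} → Walk G u v k → Walk G v w l → Walk G u w (k + l)
  walk-++ here       q = q
  walk-++ (step e p) q = step e (walk-++ p q)

  DistLe-refl : ∀ {u d} → DistLe G u u d
  DistLe-refl = 0 , z≤n , here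

  adj⇒DistLe : ∀ {u v} → Adj G u v → DistLe G u v 1
  adj⇒DistLe u~v = 1 , ≤-refl , step u~v here

  DistLe-mono : ∀ {u v d e} → d ≤ e → DistLe G u v d → DistLe G u v e
  DistLe-mono d≤e (k , k≤d , p) = k , ≤-trans k≤d d≤e , p

  DistLe-sym : ∀ {u v d} → DistLe G u v d → DistLe G v u d
  DistLe-sym (k , k≤d , p) = k , k≤d , walk-reverse p

  DistLe-trans : ∀ {u v w d e} → DistLe G u v d → DistLe G v w e → DistLe G u w (d + e)
  DistLe-trans (k , k≤d , p) (l , l≤e , q) = k + l , +-mono-≤ k≤d l≤e , walk-++ p q

  DistLe-exact : ∀ {u v d} → DistLe G u v (suc d) → ¬ DistLe G u v d → Walk G u v (suc d)
  DistLe-exact (k , k≤1+d , p) ¬d with m≤n⇒m<n∨m≡n k≤1+d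
  ... | inj₁ k<1+d = contradiction (k , ≤-pred k<1+d , p) ¬d
  ... | inj₂ refl  = p

  move : Config G → Fin n → Fin n → Config G
  move C u v = updateAt (updateAt C u (_∸ 2)) v suc

  module _ (C : Config G) {u v : Fin n} where

    move-source : Adj G u v → move C u v u ≡ C u ∸ 2
    move-source u~v = trans (updateAt-minimal u v _ (adj⇒≢ u~v)) (updateAt-updates u C)

    move-target : Adj G u v → move C u v v ≡ suc (C v)
    move-target u~v = trans (updateAt-updates v _) (cong suc (updateAt-minimal v u C (adj⇒≢ u~v ∘ sym)))

    move-other : ∀ {w} → w ≢ u → w ≢ v → move C u v w ≡ C w
    move-other w≢u w≢v = trans (updateAt-minimal _ v _ w≢v) (updateAt-minimal _ u C w≢u)

    move-PebStep : Adj G u v → 2 ≤ C u → PebStep G C (move C u v)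
    move-PebStep u~v 2≤Cu =
      u , v , u~v , 2≤Cu , move-source u~v , move-target u~v , λ _ → move-other

    ∑-move : 2 ≤ C u → suc (∑ (move C u v)) ≡ ∑ C
    ∑-move 2≤Cu = begin
      suc (∑ (move C u v)) ≡⟨ cong suc ∑-target ⟩
      suc (suc (∑ D))      ≡⟨ +-comm 2 (∑ D) ⟩
      ∑ D + 2              ≡⟨ +-cancelʳ-≡ (C u ∸ 2) _ _ ∑-source ⟩
      ∑ C                  ∎
      where
      open ≡-Reasoning
      D = updateAt C u (_∸ 2)
      ∑-target : ∑ (move C u v) ≡ suc (∑ D)
      ∑-target = +-cancelʳ-≡ (D v) _ _
        (trans (∑-updateAt D v suc) (+-suc (∑ D) (D v)))
      ∑-source : ∑ D + 2 + (C u ∸ 2) ≡ ∑ C + (C u ∸ 2)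
      ∑-source = begin
        ∑ D + 2 + (C u ∸ 2)   ≡⟨ +-assoc (∑ D) 2 _ ⟩
        ∑ D + (2 + (C u ∸ 2)) ≡⟨ cong (∑ D +_) (m+[n∸m]≡n 2≤Cu) ⟩
        ∑ D + C u             ≡⟨ ∑-updateAt C u (_∸ 2) ⟩
        ∑ C + (C u ∸ 2)       ∎

  ∑-PebStep : ∀ {C C'} → PebStep G C C' → suc (∑ C') ≡ ∑ C
  ∑-PebStep {C} {C'} (u , v , u~v , 2≤Cu , C'u , C'v , C'w) =
    trans (cong suc (sum-cong-≗ C'≗move)) (∑-move C 2≤Cu)
    where
    C'≗move : ∀ w → C' w ≡ move C u v w
    C'≗move w with w ≟ u | w ≟ v
    ... | yes refl | _        = trans C'u (sym (move-source C u~v))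
    ... | no _     | yes refl = trans C'v (sym (move-target C u~v))
    ... | no w≢u   | no w≢v   = trans (C'w w w≢u w≢v) (sym (move-other C w≢u w≢v))

  pour : ∀ {C u v} → Adj G u v → ∀ m → 2 * m ≤ C u →
         ∃[ C' ] (PebSteps G C C' × m + C v ≤ C' v)
  pour             u~v zero    _         = _ , ε , ≤-refl
  pour {C} {u} {v} u~v (suc m) 2[1+m]≤Cu =
    let C' , steps , bound = pour u~v m 2m≤C₁u
    in  C' , move-PebStep C u~v 2≤Cu ◅ steps , subst (_≤ C' v) C₁v bound
    where
    2+2m≤Cu : 2 + 2 * m ≤ C u
    2+2m≤Cu = subst (_≤ C u) (*-suc 2 m) 2[1+m]≤Cu
    2≤Cu : 2 ≤ C u
    2≤Cu = ≤-trans (m≤m+n 2 (2 * m)) 2+2m≤Cu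
    2m≤C₁u : 2 * m ≤ move C u v u
    2m≤C₁u = subst (2 * m ≤_) (sym (move-source C u~v)) (∸-monoˡ-≤ 2 2+2m≤Cu)
    C₁v : m + move C u v v ≡ suc m + C v
    C₁v = trans (cong (m +_) (move-target C u~v)) (+-suc m (C v))

  reach : ∀ {C u r k} → Walk G u r k → 2 ^ k ≤ C u →
          ∃[ C' ] (PebSteps G C C' × 1 ≤ C' r)
  reach here         1≤Cu    = _ , ε , 1≤Cu
  reach (step u~v p) 2^k+1≤Cu =
    let C₁ , steps₁ , bound    = pour u~v _ 2^k+1≤Cu
        C' , steps₂ , captured = reach p (≤-trans (m≤m+n _ _) bound)
    in  C' , steps₁ ◅◅ steps₂ , captured

  pile : Fin n → ℕ → Config G
  pile c m = updateAt (replicate n 0) c (const m)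

  size-pile : ∀ {c m} → size G (pile c m) ≡ m
  size-pile {c} {m} = begin
    size G (pile c m)        ≡⟨ size≡∑ (pile c m) ⟩
    ∑ (pile c m)             ≡⟨ +-identityʳ _ ⟨
    ∑ (pile c m) + 0         ≡⟨ ∑-updateAt (replicate n 0) c (const m) ⟩
    ∑ (replicate n 0) + m    ≡⟨ cong (_+ m) (sum-replicate-zero n) ⟩
    m                        ∎
    where open ≡-Reasoning

  pile-Winning : ∀ {c e} → EccLe G c e → Winning G (pile c (2 ^ e))
  pile-Winning {c} ecc r =
    let k , k≤e , p             = ecc r
        C' , steps , captured = reach p (subst (2 ^ k ≤_) (sym (updateAt-updates c _)) (^-monoʳ-≤ 2 k≤e))
    in  inj₂ (win C' steps (inj₁ captured))

  record Safe (C : Config G) (r : Fin n) : Set where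
    field
      few   : ∑ C ≤ 3
      free  : C r ≡ 0
      nbrs  : ∀ {u} → Adj G r u → C u ≤ 1
      nbrs² : ∀ {u w} → Adj G r u → Adj G u w → 1 ≤ C u → C w ≤ 1

  safe-uncaught : ∀ {C r} → Safe C r → ¬ 1 ≤ C r
  safe-uncaught safe = subst (λ m → ¬ 1 ≤ m) (sym (Safe.free safe)) λ ()

  Safe-PebStep : ∀ {C C' r} → Safe C r → PebStep G C C' → Safe C' r
  Safe-PebStep {C} {C'} {r} safe s@(u , v , u~v , 2≤Cu , C'u , C'v , C'w) = record
    { few   = ≤-trans ∑C'≤2 (n≤1+n 2)
    ; free  = free'
    ; nbrs  = nbrs'
    ; nbrs² = λ {x} {y} _ x~y 1≤C'x → +-cancelˡ-≤ 1 _ _ (begin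
        1 + C' y           ≤⟨ +-monoˡ-≤ (C' y) 1≤C'x ⟩
        C' x + C' y        ≡⟨ cong (C' x +_) (+-identityʳ (C' y)) ⟨
        C' x + (C' y + 0)  ≤⟨ sum-map-≤-∑ C' ((adj⇒≢ x~y ∷ []) ∷ [] ∷ []) ⟩
        ∑ C'               ≤⟨ ∑C'≤2 ⟩
        2                  ∎)
    }
    where
    open Safe safe
    open ≤-Reasoning
    ∑C'≤2 : ∑ C' ≤ 2
    ∑C'≤2 = ≤-pred (subst (_≤ 3) (sym (∑-PebStep s)) few)
    Cu≰1 : ¬ C u ≤ 1
    Cu≰1 = <⇒≱ 2≤Cu
    free' : C' r ≡ 0
    free' with r ≟ u | r ≟ v
    ... | yes refl | _        = contradiction (subst (_≤ 1) (sym free) z≤n) Cu≰1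
    ... | no _     | yes refl = contradiction (nbrs (adj-sym G u~v)) Cu≰1
    ... | no r≢u   | no r≢v   = trans (C'w r r≢u r≢v) free
    nbrs' : ∀ {x} → Adj G r x → C' x ≤ 1
    nbrs' {x} r~x with x ≟ u | x ≟ v
    ... | yes refl | _        = contradiction (nbrs r~x) Cu≰1
    ... | no x≢u   | no x≢v   = subst (_≤ 1) (sym (C'w x x≢u x≢v)) (nbrs r~x)
    ... | no _     | yes refl with C x Data.Nat.≟ 0
    ...   | yes Cv≡0 = subst (_≤ 1) (sym (trans C'v (cong suc Cv≡0))) ≤-refl
    ...   | no  Cv≢0 = contradiction (nbrs² r~x (adj-sym G u~v) (n≢0⇒n>0 Cv≢0)) Cu≰1

  Safe-PebSteps : ∀ {C C' r} → Safe C r → PebSteps G C C' → Safe C' r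
  Safe-PebSteps safe ε        = safe
  Safe-PebSteps safe (s ◅ ss) = Safe-PebSteps (Safe-PebStep safe s) ss

  Safe⇒¬CopsWin : ∀ {C r} → Safe C r → ¬ CopsWin G C r
  Safe⇒¬CopsWin safe (win C' steps (inj₁ captured)) =
    safe-uncaught (Safe-PebSteps safe steps) captured
  Safe⇒¬CopsWin safe (win C' steps (inj₂ next)) with next _ (inj₁ refl)
  ... | inj₁ captured = safe-uncaught (Safe-PebSteps safe steps) captured
  ... | inj₂ cw       = Safe⇒¬CopsWin (Safe-PebSteps safe steps) cw

  Safe-light : ∀ {C r} → ∑ C ≤ 3 → (∀ v → C v ≤ 1) → C r ≡ 0 → Safe C r
  Safe-light few light free = record
    { few = few ; free = free ; nbrs = λ {u} _ → light u ; nbrs² = λ {_} {w} _ _ _ → light w }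

  record Far (x y : Fin n) : Set where
    constructor far
    field
      {a c} : Fin n
      x~a   : Adj G x a
      c~y   : Adj G c y
      apart : ¬ DistLe G x y 3

  Far-distinct : ∀ {x y} (f : Far x y) → Unique (x ∷ Far.a f ∷ Far.c f ∷ y ∷ [])
  Far-distinct (far x~a c~y apart) =
      (adj⇒≢ x~a ∷ (λ { refl → apart (DistLe-mono (s≤s z≤n) (adj⇒DistLe c~y)) })
                  ∷ (λ { refl → apart DistLe-refl }) ∷ [])
    ∷ ((λ { refl → apart (DistLe-mono (s≤s (s≤s z≤n)) (DistLe-trans (adj⇒DistLe x~a) (adj⇒DistLe c~y))) })
                  ∷ (λ { refl → apart (DistLe-mono (s≤s z≤n) (adj⇒DistLe x~a)) }) ∷ [])
    ∷ (adj⇒≢ c~y ∷ [])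
    ∷ [] ∷ []

  Diameter⇒Far : Diameter G 4 → ¬ ¬ (∃[ x ] ∃[ y ] Far x y)
  Diameter⇒Far (ecc≤4 , minimal) no-far =
    ¬¬-∀-Fin (λ x → ¬¬-∀-Fin (close x)) (λ ecc≤3 → contradiction (minimal 3 ecc≤3) (<-irrefl refl))
    where
    close : ∀ x y → ¬ ¬ DistLe G x y 3
    close x y apart with DistLe-exact (ecc≤4 x y) apart
    ... | step x~a (step _ (step _ (step c~y here))) = no-far (x , y , far x~a c~y apart)

  module _ {C : Config G} (few : ∑ C ≤ 3) {h : Fin n} (heavy : 2 ≤ C h)
           {p : Fin n} (off-pair : ∀ w → w ≢ h → w ≢ p → C w ≡ 0) where

    shelter : ∀ {v} → ¬ DistLe G h v 1 → v ≢ p → (Adj G v p → ¬ Adj G p h) → Safe C v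
    shelter {v} h↛v v≢p ¬v~p~h = record
      { few   = few
      ; free  = off-pair v v≢h v≢p
      ; nbrs  = light-beside-heavy few heavy ∘ nbr≢h
      ; nbrs² = nbrs²
      }
      where
      v≢h : v ≢ h
      v≢h refl = h↛v DistLe-refl
      nbr≢h : ∀ {u} → Adj G v u → u ≢ h
      nbr≢h v~u refl = h↛v (adj⇒DistLe (adj-sym G v~u))
      nbrs² : ∀ {u w} → Adj G v u → Adj G u w → 1 ≤ C u → C w ≤ 1
      nbrs² {u} {w} v~u u~w 1≤Cu with w ≟ h | u ≟ p
      ... | no w≢h   | _        = light-beside-heavy few heavy w≢h
      ... | yes refl | yes refl = contradiction u~w (¬v~p~h v~u)
      ... | yes refl | no u≢p   =
        contradiction (subst (1 ≤_) (off-pair u (adj⇒≢ u~w) u≢p) 1≤Cu) λ ()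

    shelter-far : ∀ {v} → ¬ DistLe G v h 1 → ¬ DistLe G v p 1 → Safe C v
    shelter-far v↛h v↛p = shelter (v↛h ∘ DistLe-sym) (λ { refl → v↛p DistLe-refl })
      (λ v~p _ → v↛p (adj⇒DistLe v~p))

    safe-near-distant : ∀ {c y} → Adj G c y → ¬ DistLe G h y 2 → ∃ (Safe C)
    safe-near-distant {c} {y} c~y h↛y with y ≟ p
    ... | no y≢p   = y , shelter (h↛y ∘ DistLe-mono (s≤s z≤n)) y≢p λ y~p p~h →
                       h↛y (DistLe-trans (adj⇒DistLe (adj-sym G p~h)) (adj⇒DistLe (adj-sym G y~p)))
    ... | yes refl = c , shelter (λ h-c → h↛y (DistLe-trans h-c (adj⇒DistLe c~y)))
                       (adj⇒≢ c~y) λ _ y~h → h↛y (DistLe-mono (s≤s z≤n) (adj⇒DistLe (adj-sym G y~h)))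

    safe-beside-heavy : ∀ {x y} → Far x y → ¬ ¬ ∃ (Safe C)
    safe-beside-heavy {x} {y} f no-safe = ¬¬-excluded-middle λ where
      (yes x-h) → no-safe (safe-near-distant (Far.c~y f) (Far.apart f ∘ DistLe-trans x-h))
      (no x↛h)  → ¬¬-excluded-middle λ where
        (yes y-h) → no-safe (safe-near-distant (adj-sym G (Far.x~a f)) (Far.apart f ∘ DistLe-sym ∘ DistLe-trans y-h))
        (no y↛h)  → ¬¬-excluded-middle λ where
          (no x↛p)  → no-safe (x , shelter-far x↛h x↛p)
          (yes x-p) → no-safe (y , shelter-far y↛h λ y-p →
                        Far.apart f (DistLe-mono (s≤s (s≤s z≤n)) (DistLe-trans x-p (DistLe-sym y-p))))

  safe-vertex : ∀ {C x y} → ∑ C ≤ 3 → Far x y → ¬ ¬ ∃ (Safe C)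
  safe-vertex {C} few f with any? (λ h → 2 ≤? C h)
  ... | yes (h , heavy) = let p , off-pair = vanishes-off-pair few heavy
                          in  safe-beside-heavy few heavy off-pair f
  ... | no  no-heavy    = λ no-safe →
    let r , vacant = satisfied (vacant-among C (Far-distinct f) (s≤s few))
    in  no-safe (r , Safe-light few light vacant)
    where
    light : ∀ v → C v ≤ 1
    light v = ≤-pred (≰⇒> λ 2≤Cv → no-heavy (v , 2≤Cv))

  -- Adjacency is not decidable, so the safe vertex is only found under double negation;
  -- that suffices because 4 ≤ size G C is decidable.
  Winning⇒4≤size : ∀ {C} → Diameter G 4 → Winning G C → 4 ≤ size G C
  Winning⇒4≤size {C} diam winning = decidable-stable (4 ≤? size G C) λ size≱4 →
    Diameter⇒Far diam λ (x , y , f) →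
    safe-vertex (subst (_≤ 3) (size≡∑ C) (≤-pred (≰⇒> size≱4))) f λ (r , safe) →
    [ safe-uncaught safe , Safe⇒¬CopsWin safe ] (winning r)

theorem12 : (n : ℕ) (T : Graph n) → IsTree T → Radius T 2 → Diameter T 4 →
    CopPebblingNumber T 4
theorem12 n T _ ((c , ecc≤2) , _) diam =
  (pile T c 4 , size-pile T , pile-Winning T ecc≤2) , λ C → Winning⇒4≤size T diam
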